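{- Let $q=2$, $d\leq e$ positive integers, $0\leq i\leq d$, $1\leq j\leq d$, and $h=\min\{j,d-i\}$. Let $T_h(i,j)=(-1)^{j-h}2^{eh+\binom{j-h}{2}}{d-h \brack d-j}_2{d-i \brack h}_2$ and $B_j(i)=\sum_{t=0}^{h}T_t(i,j)$. Then $1\geq \frac{|B_j(i)|}{|T_h(i,j)|}\geq k$, where (i) $k=1/3$ if $d-i<j$ and $e\geq d+1$; (ii) $k=2/3$ if $d-i>j$ and $e\geq d+1$; (iii) $k=1/2$ if $d-i=j$ and $e\geq d+2$; (iv) $k=\dfrac{2^{d+1-j}+2^j-1}{2^{d+1}}$ if $d-i=j$ and $e=d+1$.
   Context: For integers $N\geq 0$ and $k$, ${N \brack k}_2=\prod_{t=1}^{k}\frac{2^{N-k+t}-1}{2^t-1}$ if $0\leq k\leq N$, and $0$ if $k<0$ or $k>N$. $B_j(i)$ is the $i$-th eigenvalue of the bilinear forms graph $H_2(d,e,j)$. -}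

module Defs where

open import Data.Nat using (ℕ; zero; suc; _+_; _*_; _∸_; _^_; _≤ᵇ_; _⊓_; NonZero; >-nonZero; _≤_; s≤s; z≤n)
open import Data.Nat.Properties using (≤-refl; *-mono-≤; ∸-monoˡ-≤; m^n>0)
open import Data.Nat.DivMod using (_/_)
open import Data.Nat.Combinatorics using (_C_)
open import Data.Bool using (if_then_else_)
open import Data.Integer as ℤ using (ℤ; +_; -1ℤ)

prod1 : ℕ → (ℕ → ℕ) → ℕ
prod1 zero    f = 1
prod1 (suc k) f = prod1 k f * f (suc k)

gnum : ℕ → ℕ → ℕ
gnum N k = prod1 k (λ t → 2 ^ (N ∸ k + t) ∸ 1)

gden : ℕ → ℕ
gden k = prod1 k (λ t → 2 ^ t ∸ 1)

private
  factor≥1 : ∀ s → 1 ≤ 2 ^ suc s ∸ 1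
  factor≥1 s = ∸-monoˡ-≤ 1 (*-mono-≤ {2} {2} {1} {2 ^ s} ≤-refl (m^n>0 2 s))

  gden≥1 : ∀ k → 1 ≤ gden k
  gden≥1 zero = s≤s z≤n
  gden≥1 (suc k) = *-mono-≤ {1} {gden k} {1} (gden≥1 k) (factor≥1 k)

gden-nonZero : ∀ k → NonZero (gden k)
gden-nonZero k = >-nonZero (gden≥1 k)

-- Gaussian binomial coefficient [N brack k]_2 (the quotient is exact);
-- 0 when k > N (k < 0 cannot occur for k : ℕ).
gauss : ℕ → ℕ → ℕ
gauss N k = if k ≤ᵇ N then _/_ (gnum N k) (gden k) {{gden-nonZero k}} else 0

T : (d e i j t : ℕ) → ℤ
T d e i j t = (-1ℤ ℤ.^ (j ∸ t)) ℤ.* (+ (2 ^ (e * t + ((j ∸ t) C 2)) * gauss (d ∸ t) (d ∸ j) * gauss (d ∸ i) t))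

hh : (d i j : ℕ) → ℕ
hh d i j = j ⊓ (d ∸ i)

sum0 : ℕ → (ℕ → ℤ) → ℤ
sum0 zero    f = f 0
sum0 (suc n) f = sum0 n f ℤ.+ f (suc n)

B : (d e i j : ℕ) → ℤ
B d e i j = sum0 (hh d i j) (T d e i j)

-- Write a_t = |T_t(i,j)|, n = d − i and h = min(j, n). Through the q-Pascal rule the Gaussian
-- binomials become exact products of Mersenne numbers 2^k − 1, so a_t / a_(t+1) is an explicit
-- quotient of powers of 2 and Mersenne numbers. For d ≤ e it is at most 1 when
-- t + 1 < h, hence B_j(i) = ±(a_h − a_(h−1) + a_(h−2) − ⋯) satisfies |B_j(i)| = |a_h − S| with
-- 0 ≤ S ≤ a_(h−1). So |B_j(i)| ≤ a_h follows from a_(h−1) ≤ 2 a_h, and |B_j(i)| ≥ k a_h from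
-- a_(h−1) ≤ (1 − k) a_h: in each case an estimate of the quotient, which in case (iv) is an equality.

module Submission where

open import Defs
open import Data.Nat using (ℕ; _≤_; _<_; _>_; _∸_; _^_; _+_; _*_)
open import Data.Integer using (ℤ; ∣_∣)
open import Relation.Binary.PropositionalEquality using (_≡_; _≢_)
open import Data.Product using (_×_)

open import Data.Nat using (zero; suc; _⊓_; s≤s; z≤n; NonZero; >-nonZero; _≤ᵇ_; ∣_-_∣)
open import Data.Nat.Properties
open import Data.Nat.DivMod using (_/_; m*n/n≡m)
open import Data.Nat.Combinatorics using (_C_; nCk+nC[k+1]≡[n+1]C[k+1]; nC1≡n)
open import Data.Nat.Tactic.RingSolver using (solve-∀)
open import Algebra.Properties.CommutativeSemigroup *-commutativeSemigroup
  using (xy∙z≈y∙xz; xy∙z≈x∙zy; xy∙z≈xz∙y; x∙yz≈yx∙z; x∙yz≈y∙zx; x∙yz≈zx∙y; x∙yz≈zy∙x; x∙yz≈y∙xz)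
open import Data.Bool using (true)
open import Data.Integer as ℤ using (-1ℤ)
import Data.Integer.Properties as ℤₚ
import Data.Integer.Tactic.RingSolver as ℤ-Solver
open import Data.Product using (_,_)
open import Data.Sum using (inj₁; inj₂)
open import Relation.Binary.PropositionalEquality
  using (refl; sym; trans; cong; cong₂; subst; subst₂; module ≡-Reasoning)

m∸o≡[n∸o]+[m∸n] : ∀ {o n m} → o ≤ n → n ≤ m → m ∸ o ≡ (n ∸ o) + (m ∸ n)
m∸o≡[n∸o]+[m∸n] {o} {n} {m} o≤n n≤m = begin
  m ∸ o              ≡⟨ cong (_∸ o) (sym (m∸n+n≡m n≤m)) ⟩
  (m ∸ n) + n ∸ o    ≡⟨ +-∸-assoc (m ∸ n) o≤n ⟩
  (m ∸ n) + (n ∸ o)  ≡⟨ +-comm (m ∸ n) (n ∸ o) ⟩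
  (n ∸ o) + (m ∸ n)  ∎
  where open ≡-Reasoning

m≡[n∸o]+o+[m∸n] : ∀ {o n m} → o ≤ n → n ≤ m → m ≡ (n ∸ o) + o + (m ∸ n)
m≡[n∸o]+o+[m∸n] {o} {n} {m} o≤n n≤m = sym (trans (cong (_+ (m ∸ n)) (m∸n+n≡m o≤n)) (m+[n∸m]≡n n≤m))

m∸n≡1+[m∸1+n] : ∀ {m n} → suc n ≤ m → m ∸ n ≡ suc (m ∸ suc n)
m∸n≡1+[m∸1+n] {n = zero}  (s≤s _)   = refl
m∸n≡1+[m∸1+n] {n = suc n} (s≤s n<m) = m∸n≡1+[m∸1+n] n<m

C[1+n,2]≡C[n,2]+n : ∀ n → suc n C 2 ≡ n C 2 + n
C[1+n,2]≡C[n,2]+n n = begin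
  suc n C 2      ≡⟨ sym (nCk+nC[k+1]≡[n+1]C[k+1] n 1) ⟩
  n C 1 + n C 2  ≡⟨ cong (_+ n C 2) (nC1≡n n) ⟩
  n + n C 2      ≡⟨ +-comm n (n C 2) ⟩
  n C 2 + n      ∎
  where open ≡-Reasoning

2^[a+C[1+u,2]]≡2^[a+C[u,2]]*2^u : ∀ a u → 2 ^ (a + suc u C 2) ≡ 2 ^ (a + u C 2) * 2 ^ u
2^[a+C[1+u,2]]≡2^[a+C[u,2]]*2^u a u = begin
  2 ^ (a + suc u C 2)      ≡⟨ cong (λ x → 2 ^ (a + x)) (C[1+n,2]≡C[n,2]+n u) ⟩
  2 ^ (a + (u C 2 + u))    ≡⟨ cong (2 ^_) (sym (+-assoc a (u C 2) u)) ⟩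
  2 ^ (a + u C 2 + u)      ≡⟨ ^-distribˡ-+-* 2 (a + u C 2) u ⟩
  2 ^ (a + u C 2) * 2 ^ u  ∎
  where open ≡-Reasoning

2^[e*[1+s]+c]≡2^e*2^[e*s+c] : ∀ e s c → 2 ^ (e * suc s + c) ≡ 2 ^ e * 2 ^ (e * s + c)
2^[e*[1+s]+c]≡2^e*2^[e*s+c] e s c = begin
  2 ^ (e * suc s + c)      ≡⟨ cong (λ x → 2 ^ (x + c)) (*-suc e s) ⟩
  2 ^ (e + e * s + c)      ≡⟨ cong (2 ^_) (+-assoc e (e * s) c) ⟩
  2 ^ (e + (e * s + c))    ≡⟨ ^-distribˡ-+-* 2 e (e * s + c) ⟩
  2 ^ e * 2 ^ (e * s + c)  ∎
  where open ≡-Reasoning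

∣+m-+n∣≡∣m-n∣ : ∀ m n → ∣ ℤ.+ m ℤ.- ℤ.+ n ∣ ≡ ∣ m - n ∣
∣+m-+n∣≡∣m-n∣ m n with ≤-total m n
... | inj₁ m≤n = trans (cong ∣_∣ (ℤₚ.[+m]-[+n]≡m⊖n m n))
                   (trans (ℤₚ.∣⊖∣-≤ m≤n) (sym (m≤n⇒∣m-n∣≡n∸m m≤n)))
... | inj₂ n≤m = trans (cong ∣_∣ (ℤₚ.[+m]-[+n]≡m⊖n m n))
                   (trans (ℤₚ.∣m⊖n∣≡∣n⊖m∣ m n)
                   (trans (ℤₚ.∣⊖∣-≤ n≤m) (trans (sym (m≤n⇒∣m-n∣≡n∸m n≤m)) (∣-∣-comm n m))))

∣m-n∣≤m : ∀ {m n} → n ≤ 2 * m → ∣ m - n ∣ ≤ m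
∣m-n∣≤m {m} {n} n≤2m with ∣m-n∣≡[m∸n]∨[n∸m] m n
... | inj₁ ∣m-n∣≡m∸n = subst (_≤ m) (sym ∣m-n∣≡m∸n) (m∸n≤m m n)
... | inj₂ ∣m-n∣≡n∸m = subst (_≤ m) (sym ∣m-n∣≡n∸m) (begin
  n ∸ m      ≤⟨ ∸-monoˡ-≤ m n≤2m ⟩
  2 * m ∸ m  ≡⟨ m+n∸m≡n m (1 * m) ⟩
  1 * m      ≡⟨ *-identityˡ m ⟩
  m          ∎)
  where open ≤-Reasoning

mersenne : ℕ → ℕ
mersenne x = 2 ^ x ∸ 1

suc-mersenne : ∀ x → suc (mersenne x) ≡ 2 ^ x
suc-mersenne x = trans (+-comm 1 (mersenne x)) (m∸n+n≡m (m^n>0 2 x))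

mersenne≤2^ : ∀ x → mersenne x ≤ 2 ^ x
mersenne≤2^ x = m∸n≤m (2 ^ x) 1

mersenne-+ : ∀ a b → mersenne (a + b) ≡ mersenne a + 2 ^ a * mersenne b
mersenne-+ a b = suc-injective (begin
  suc (mersenne (a + b))                 ≡⟨ suc-mersenne (a + b) ⟩
  2 ^ (a + b)                            ≡⟨ ^-distribˡ-+-* 2 a b ⟩
  2 ^ a * 2 ^ b                          ≡⟨ cong (2 ^ a *_) (sym (suc-mersenne b)) ⟩
  2 ^ a * suc (mersenne b)               ≡⟨ *-suc (2 ^ a) (mersenne b) ⟩
  2 ^ a + 2 ^ a * mersenne b             ≡⟨ cong (_+ 2 ^ a * mersenne b) (sym (suc-mersenne a)) ⟩
  suc (mersenne a) + 2 ^ a * mersenne b  ∎)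
  where open ≡-Reasoning

2^≤mersenne-suc : ∀ x → 2 ^ x ≤ mersenne (suc x)
2^≤mersenne-suc x = begin
  2 ^ x               ≡⟨ sym (suc-mersenne x) ⟩
  1 + mersenne x      ≤⟨ +-monoʳ-≤ 1 (m≤n*m (mersenne x) 2) ⟩
  1 + 2 * mersenne x  ≡⟨ sym (mersenne-+ 1 x) ⟩
  mersenne (suc x)    ∎
  where open ≤-Reasoning

3*2^≤mersenne-2+ : ∀ x → 3 * 2 ^ x ≤ mersenne (2 + x)
3*2^≤mersenne-2+ x = begin
  3 * 2 ^ x               ≡⟨ cong (3 *_) (sym (suc-mersenne x)) ⟩
  3 * suc (mersenne x)    ≡⟨ *-suc 3 (mersenne x) ⟩
  3 + 3 * mersenne x      ≤⟨ +-monoʳ-≤ 3 (*-monoˡ-≤ (mersenne x) (n≤1+n 3)) ⟩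
  3 + 4 * mersenne x      ≡⟨ sym (mersenne-+ 2 x) ⟩
  mersenne (2 + x)        ∎
  where open ≤-Reasoning

1≤mersenne-suc : ∀ x → 1 ≤ mersenne (suc x)
1≤mersenne-suc x = ≤-trans (m^n>0 2 x) (2^≤mersenne-suc x)

3≤mersenne : ∀ {x} → 2 ≤ x → 3 ≤ mersenne x
3≤mersenne (s≤s (s≤s {n = x} _)) = ≤-trans (*-monoʳ-≤ 3 (m^n>0 2 x)) (3*2^≤mersenne-2+ x)

-- Gaussian binomials

-- qbinom c k = [c + k, k]₂ by the q-Pascal rule; mersenneProd c k = (2^(c+1) − 1) ⋯ (2^(c+k) − 1)
-- is the numerator gnum (c + k) k.
qbinom : ℕ → ℕ → ℕ
qbinom c       zero    = 1
qbinom zero    (suc k) = 1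
qbinom (suc c) (suc k) = qbinom (suc c) k + 2 ^ suc k * qbinom c (suc k)

mersenneProd : ℕ → ℕ → ℕ
mersenneProd c k = prod1 k (λ t → mersenne (c + t))

mersenneProd-suc : ∀ c k → mersenneProd c (suc k) ≡ mersenne (suc c) * mersenneProd (suc c) k
mersenneProd-suc c zero = begin
  1 * mersenne (c + 1)  ≡⟨ *-identityˡ _ ⟩
  mersenne (c + 1)      ≡⟨ cong mersenne (+-comm c 1) ⟩
  mersenne (suc c)      ≡⟨ sym (*-identityʳ _) ⟩
  mersenne (suc c) * 1  ∎
  where open ≡-Reasoning
mersenneProd-suc c (suc k) = begin
  mersenneProd c (suc k) * mersenne (c + suc (suc k))
    ≡⟨ cong₂ _*_ (mersenneProd-suc c k) (cong mersenne (+-suc c (suc k))) ⟩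
  mersenne (suc c) * mersenneProd (suc c) k * mersenne (suc c + suc k)
    ≡⟨ *-assoc (mersenne (suc c)) _ _ ⟩
  mersenne (suc c) * (mersenneProd (suc c) k * mersenne (suc c + suc k))
    ∎
  where open ≡-Reasoning

qbinom*gden≡mersenneProd : ∀ c k → qbinom c k * gden k ≡ mersenneProd c k
qbinom*gden≡mersenneProd c       zero    = refl
qbinom*gden≡mersenneProd zero    (suc k) = +-identityʳ _
qbinom*gden≡mersenneProd (suc c) (suc k) = begin
  (Q₁ + 2 ^ suc k * Q₂) * (gden k * M (suc k))
    ≡⟨ distribute Q₁ Q₂ (gden k) (M (suc k)) (2 ^ suc k) ⟩
  Q₁ * gden k * M (suc k) + 2 ^ suc k * (Q₂ * (gden k * M (suc k)))
    ≡⟨ cong₂ (λ x y → x * M (suc k) + 2 ^ suc k * y)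
             (qbinom*gden≡mersenneProd (suc c) k) (qbinom*gden≡mersenneProd c (suc k)) ⟩
  P * M (suc k) + 2 ^ suc k * mersenneProd c (suc k)
    ≡⟨ cong (λ y → P * M (suc k) + 2 ^ suc k * y) (mersenneProd-suc c k) ⟩
  P * M (suc k) + 2 ^ suc k * (M (suc c) * P)
    ≡⟨ factor P (M (suc k)) (2 ^ suc k) (M (suc c)) ⟩
  P * (M (suc k) + 2 ^ suc k * M (suc c))
    ≡⟨ cong (P *_) (sym (mersenne-+ (suc k) (suc c))) ⟩
  P * M (suc k + suc c)
    ≡⟨ cong (λ x → P * M x) (+-comm (suc k) (suc c)) ⟩
  P * M (suc c + suc k)
    ∎
  where
  open ≡-Reasoning
  M = mersenne
  Q₁ = qbinom (suc c) k
  Q₂ = qbinom c (suc k)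
  P = mersenneProd (suc c) k
  distribute : ∀ a b g x p → (a + p * b) * (g * x) ≡ a * g * x + p * (b * (g * x))
  distribute = solve-∀
  factor : ∀ a x p y → a * x + p * (y * a) ≡ a * (x + p * y)
  factor = solve-∀

gauss-+ : ∀ c k → gauss (c + k) k ≡ qbinom c k
gauss-+ c k with k ≤ᵇ c + k | ≤⇒≤ᵇ (m≤n+m k c)
... | true | _ = begin
  mersenneProd (c + k ∸ k) k / gden k  ≡⟨ cong (λ c′ → mersenneProd c′ k / gden k) (m+n∸n≡m c k) ⟩
  mersenneProd c k / gden k            ≡⟨ cong (_/ gden k) (sym (qbinom*gden≡mersenneProd c k)) ⟩
  qbinom c k * gden k / gden k         ≡⟨ m*n/n≡m (qbinom c k) (gden k) ⟩
  qbinom c k                           ∎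
  where
  open ≡-Reasoning
  instance
    gden≢0 : NonZero (gden k)
    gden≢0 = gden-nonZero k

qbinom-pos : ∀ c k → 1 ≤ qbinom c k
qbinom-pos c       zero    = ≤-refl
qbinom-pos zero    (suc k) = ≤-refl
qbinom-pos (suc c) (suc k) = ≤-trans (qbinom-pos (suc c) k) (m≤m+n _ _)

qbinom-top : ∀ c m → qbinom (suc c) m * mersenne (suc c) ≡ qbinom c m * mersenne (c + suc m)
qbinom-top c m = *-cancelʳ-≡ _ _ (gden m) {{gden-nonZero m}} (begin
  qbinom (suc c) m * mersenne (suc c) * gden m    ≡⟨ xy∙z≈y∙xz (qbinom (suc c) m) (mersenne (suc c)) (gden m) ⟩
  mersenne (suc c) * (qbinom (suc c) m * gden m)  ≡⟨ cong (mersenne (suc c) *_) (qbinom*gden≡mersenneProd (suc c) m) ⟩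
  mersenne (suc c) * mersenneProd (suc c) m       ≡⟨ sym (mersenneProd-suc c m) ⟩
  mersenneProd c m * mersenne (c + suc m)         ≡⟨ cong (_* mersenne (c + suc m)) (sym (qbinom*gden≡mersenneProd c m)) ⟩
  qbinom c m * gden m * mersenne (c + suc m)      ≡⟨ xy∙z≈xz∙y (qbinom c m) (gden m) (mersenne (c + suc m)) ⟩
  qbinom c m * mersenne (c + suc m) * gden m      ∎)
  where open ≡-Reasoning

qbinom-bottom : ∀ c s → qbinom c (suc s) * mersenne (suc s) ≡ qbinom (suc c) s * mersenne (suc c)
qbinom-bottom c s = *-cancelʳ-≡ _ _ (gden s) {{gden-nonZero s}} (begin
  qbinom c (suc s) * mersenne (suc s) * gden s    ≡⟨ xy∙z≈x∙zy (qbinom c (suc s)) (mersenne (suc s)) (gden s) ⟩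
  qbinom c (suc s) * gden (suc s)                 ≡⟨ qbinom*gden≡mersenneProd c (suc s) ⟩
  mersenneProd c (suc s)                          ≡⟨ mersenneProd-suc c s ⟩
  mersenne (suc c) * mersenneProd (suc c) s       ≡⟨ cong (mersenne (suc c) *_) (sym (qbinom*gden≡mersenneProd (suc c) s)) ⟩
  mersenne (suc c) * (qbinom (suc c) s * gden s)  ≡⟨ x∙yz≈yx∙z (mersenne (suc c)) (qbinom (suc c) s) (gden s) ⟩
  qbinom (suc c) s * mersenne (suc c) * gden s    ∎)
  where open ≡-Reasoning

-- Consecutive terms

-- absT d e n j t = |T_t(i,j)| for n = d − i.
absT : (d e n j t : ℕ) → ℕ
absT d e n j t = 2 ^ (e * t + (j ∸ t) C 2) * gauss (d ∸ t) (d ∸ j) * gauss n t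

absT≡ : ∀ {d e n j t} → t ≤ j → j ≤ d → t ≤ n →
  absT d e n j t ≡ 2 ^ (e * t + (j ∸ t) C 2) * qbinom (j ∸ t) (d ∸ j) * qbinom (n ∸ t) t
absT≡ {d} {e} {n} {j} {t} t≤j j≤d t≤n = cong₂ (λ x y → 2 ^ (e * t + (j ∸ t) C 2) * x * y)
  (trans (cong (λ N → gauss N (d ∸ j)) (m∸o≡[n∸o]+[m∸n] t≤j j≤d)) (gauss-+ (j ∸ t) (d ∸ j)))
  (trans (cong (λ N → gauss N t) (sym (m∸n+n≡m t≤n))) (gauss-+ (n ∸ t) t))

absT-pos : ∀ {d e n j t} → t ≤ j → j ≤ d → t ≤ n → 1 ≤ absT d e n j t
absT-pos {d} {e} {n} {j} {t} t≤j j≤d t≤n = subst (1 ≤_) (sym (absT≡ {e = e} t≤j j≤d t≤n))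
  (*-mono-≤ (*-mono-≤ (m^n>0 2 (e * t + (j ∸ t) C 2)) (qbinom-pos (j ∸ t) (d ∸ j))) (qbinom-pos (n ∸ t) t))

ratioNum : (u m s : ℕ) → ℕ
ratioNum u m s = 2 ^ u * mersenne (u + suc m) * mersenne (suc s)

ratioDen : (u v e : ℕ) → ℕ
ratioDen u v e = 2 ^ e * mersenne (suc u) * mersenne (suc v)

absT-ratio : ∀ {d e n j s} → suc s ≤ j → suc s ≤ n → j ≤ d →
  absT d e n j s * ratioDen (j ∸ suc s) (n ∸ suc s) e ≡ absT d e n j (suc s) * ratioNum (j ∸ suc s) (d ∸ j) s
absT-ratio {d} {e} {n} {j} {s} s<j s<n j≤d = begin
  absT d e n j s * ratioDen u v e
    ≡⟨ cong (_* ratioDen u v e) absT-s ⟩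
  K * 2 ^ u * qbinom (suc u) m * qbinom (suc v) s * (2 ^ e * M (suc u) * M (suc v))
    ≡⟨ pair-up K (2 ^ u) (2 ^ e) _ _ _ _ ⟩
  2 ^ e * K * 2 ^ u * (qbinom (suc u) m * M (suc u)) * (qbinom (suc v) s * M (suc v))
    ≡⟨ cong₂ (λ x y → 2 ^ e * K * 2 ^ u * x * y) (qbinom-top u m) (sym (qbinom-bottom v s)) ⟩
  2 ^ e * K * 2 ^ u * (qbinom u m * M (u + suc m)) * (qbinom v (suc s) * M (suc s))
    ≡⟨ unpair (2 ^ e) K (2 ^ u) _ _ _ _ ⟩
  2 ^ e * K * qbinom u m * qbinom v (suc s) * ratioNum u m s
    ≡⟨ cong (_* ratioNum u m s) (sym absT-suc-s) ⟩
  absT d e n j (suc s) * ratioNum u m s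
    ∎
  where
  open ≡-Reasoning
  M = mersenne
  u = j ∸ suc s
  v = n ∸ suc s
  m = d ∸ j
  K = 2 ^ (e * s + u C 2)
  pair-up : ∀ K P E g h x y → K * P * g * h * (E * x * y) ≡ E * K * P * (g * x) * (h * y)
  pair-up = solve-∀
  unpair : ∀ E K P g h x y → E * K * P * (g * x) * (h * y) ≡ E * K * g * h * (P * x * y)
  unpair = solve-∀
  absT-s : absT d e n j s ≡ K * 2 ^ u * qbinom (suc u) m * qbinom (suc v) s
  absT-s = begin
    absT d e n j s
      ≡⟨ absT≡ {e = e} (<⇒≤ s<j) j≤d (<⇒≤ s<n) ⟩
    2 ^ (e * s + (j ∸ s) C 2) * qbinom (j ∸ s) m * qbinom (n ∸ s) s
      ≡⟨ cong₂ (λ x y → 2 ^ (e * s + x C 2) * qbinom x m * qbinom y s) (m∸n≡1+[m∸1+n] s<j) (m∸n≡1+[m∸1+n] s<n) ⟩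
    2 ^ (e * s + suc u C 2) * qbinom (suc u) m * qbinom (suc v) s
      ≡⟨ cong (λ x → x * qbinom (suc u) m * qbinom (suc v) s) (2^[a+C[1+u,2]]≡2^[a+C[u,2]]*2^u (e * s) u) ⟩
    K * 2 ^ u * qbinom (suc u) m * qbinom (suc v) s
      ∎
  absT-suc-s : absT d e n j (suc s) ≡ 2 ^ e * K * qbinom u m * qbinom v (suc s)
  absT-suc-s = trans (absT≡ {e = e} s<j j≤d s<n) (cong (λ x → x * qbinom u m * qbinom v (suc s)) (2^[e*[1+s]+c]≡2^e*2^[e*s+c] e s (u C 2)))

ratioDen≥ : ∀ {a b} u v e → a ≤ mersenne (suc u) → b ≤ mersenne (suc v) → 2 ^ e * a * b ≤ ratioDen u v e
ratioDen≥ u v e a≤ b≤ = *-mono-≤ (*-monoʳ-≤ (2 ^ e) a≤) b≤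

ratioDen-pos : ∀ u v e → 1 ≤ ratioDen u v e
ratioDen-pos u v e = *-mono-≤ (*-mono-≤ (m^n>0 2 e) (1≤mersenne-suc u)) (1≤mersenne-suc v)

ratioDen-nonZero : ∀ u v e → NonZero (ratioDen u v e)
ratioDen-nonZero u v e = >-nonZero (ratioDen-pos u v e)

ratioNum≤ : ∀ {d} u m s → d ≡ u + suc s + m → ratioNum u m s ≤ 2 ^ u * 2 ^ suc d
ratioNum≤ u m s refl = begin
  2 ^ u * mersenne (u + suc m) * mersenne (suc s)
    ≤⟨ *-mono-≤ (*-monoʳ-≤ (2 ^ u) (mersenne≤2^ (u + suc m))) (mersenne≤2^ (suc s)) ⟩
  2 ^ u * 2 ^ (u + suc m) * 2 ^ suc s
    ≡⟨ *-assoc (2 ^ u) _ _ ⟩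
  2 ^ u * (2 ^ (u + suc m) * 2 ^ suc s)
    ≡⟨ cong (2 ^ u *_) (sym (^-distribˡ-+-* 2 (u + suc m) (suc s))) ⟩
  2 ^ u * 2 ^ (u + suc m + suc s)
    ≡⟨ cong (λ x → 2 ^ u * 2 ^ x) (exponent u m s) ⟩
  2 ^ u * 2 ^ suc (u + suc s + m)
    ∎
  where
  open ≤-Reasoning
  exponent : ∀ u m s → u + (1 + m) + (1 + s) ≡ 1 + (u + (1 + s) + m)
  exponent = solve-∀

ratio≤2 : ∀ {d e} u v m s → d ≡ u + suc s + m → d ≤ e → ratioNum u m s ≤ 2 * ratioDen u v e
ratio≤2 {d} {e} u v m s d≡ d≤e = begin
  ratioNum u m s           ≤⟨ ratioNum≤ u m s d≡ ⟩
  2 ^ u * 2 ^ suc d        ≤⟨ *-monoʳ-≤ (2 ^ u) (^-monoʳ-≤ 2 (s≤s d≤e)) ⟩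
  2 ^ u * (2 * 2 ^ e)      ≡⟨ x∙yz≈y∙zx (2 ^ u) 2 (2 ^ e) ⟩
  2 * (2 ^ e * 2 ^ u)      ≡⟨ cong (2 *_) (sym (*-identityʳ (2 ^ e * 2 ^ u))) ⟩
  2 * (2 ^ e * 2 ^ u * 1)  ≤⟨ *-monoʳ-≤ 2 (ratioDen≥ u v e (2^≤mersenne-suc u) (1≤mersenne-suc v)) ⟩
  2 * ratioDen u v e       ∎
  where open ≤-Reasoning

ratio≤1 : ∀ {d e} u v m s → d ≡ u + suc s + m → d ≤ e → 1 ≤ v → ratioNum u m s ≤ 1 * ratioDen u v e
ratio≤1 {d} {e} u v m s d≡ d≤e 1≤v = begin
  ratioNum u m s           ≤⟨ ratioNum≤ u m s d≡ ⟩
  2 ^ u * 2 ^ suc d        ≤⟨ *-monoʳ-≤ (2 ^ u) (^-monoʳ-≤ 2 (s≤s d≤e)) ⟩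
  2 ^ u * (2 * 2 ^ e)      ≡⟨ x∙yz≈zx∙y (2 ^ u) 2 (2 ^ e) ⟩
  2 ^ e * 2 ^ u * 2        ≤⟨ ratioDen≥ u v e (2^≤mersenne-suc u) (≤-trans (n≤1+n 2) (3≤mersenne (s≤s 1≤v))) ⟩
  ratioDen u v e           ≡⟨ sym (*-identityˡ _) ⟩
  1 * ratioDen u v e       ∎
  where open ≤-Reasoning

ratio≤2/3 : ∀ {d e} u v m s → d ≡ u + suc s + m → 1 ≤ u → suc d ≤ e → 3 * ratioNum u m s ≤ 2 * ratioDen u v e
ratio≤2/3 {d} {e} u v m s d≡ (s≤s {n = u′} z≤n) d<e = begin
  3 * ratioNum u m s              ≤⟨ *-monoʳ-≤ 3 (ratioNum≤ u m s d≡) ⟩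
  3 * (2 ^ u * 2 ^ suc d)         ≤⟨ *-monoʳ-≤ 3 (*-monoʳ-≤ (2 ^ u) (^-monoʳ-≤ 2 d<e)) ⟩
  3 * (2 * 2 ^ u′ * 2 ^ e)        ≡⟨ rearrange (2 ^ u′) (2 ^ e) ⟩
  2 * (2 ^ e * (3 * 2 ^ u′) * 1)  ≤⟨ *-monoʳ-≤ 2 (ratioDen≥ u v e (3*2^≤mersenne-2+ u′) (1≤mersenne-suc v)) ⟩
  2 * ratioDen u v e              ∎
  where
  open ≤-Reasoning
  rearrange : ∀ p q → 3 * (2 * p * q) ≡ 2 * (q * (3 * p) * 1)
  rearrange = solve-∀

ratio≤1/3 : ∀ {d e} u v m s → d ≡ u + suc s + m → 1 ≤ v → suc d ≤ e → 3 * ratioNum u m s ≤ 1 * ratioDen u v e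
ratio≤1/3 {d} {e} u v m s d≡ 1≤v d<e = begin
  3 * ratioNum u m s       ≤⟨ *-monoʳ-≤ 3 (ratioNum≤ u m s d≡) ⟩
  3 * (2 ^ u * 2 ^ suc d)  ≤⟨ *-monoʳ-≤ 3 (*-monoʳ-≤ (2 ^ u) (^-monoʳ-≤ 2 d<e)) ⟩
  3 * (2 ^ u * 2 ^ e)      ≡⟨ x∙yz≈zy∙x 3 (2 ^ u) (2 ^ e) ⟩
  2 ^ e * 2 ^ u * 3        ≤⟨ ratioDen≥ u v e (2^≤mersenne-suc u) (3≤mersenne (s≤s 1≤v)) ⟩
  ratioDen u v e           ≡⟨ sym (*-identityˡ _) ⟩
  1 * ratioDen u v e       ∎
  where open ≤-Reasoning

ratio≤1/2 : ∀ {d e} u v m s → d ≡ u + suc s + m → suc (suc d) ≤ e → 2 * ratioNum u m s ≤ 1 * ratioDen u v e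
ratio≤1/2 {d} {e} u v m s d≡ d+1<e = begin
  2 * ratioNum u m s       ≤⟨ *-monoʳ-≤ 2 (ratioNum≤ u m s d≡) ⟩
  2 * (2 ^ u * 2 ^ suc d)  ≡⟨ x∙yz≈y∙xz 2 (2 ^ u) (2 ^ suc d) ⟩
  2 ^ u * 2 ^ suc (suc d)  ≤⟨ *-monoʳ-≤ (2 ^ u) (^-monoʳ-≤ 2 d+1<e) ⟩
  2 ^ u * 2 ^ e            ≡⟨ trans (*-comm (2 ^ u) (2 ^ e)) (sym (*-identityʳ _)) ⟩
  2 ^ e * 2 ^ u * 1        ≤⟨ ratioDen≥ u v e (2^≤mersenne-suc u) (1≤mersenne-suc v) ⟩
  ratioDen u v e           ≡⟨ sym (*-identityˡ _) ⟩
  1 * ratioDen u v e       ∎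
  where open ≤-Reasoning

ratio-tight : ∀ {d e j u v} m s → u ≡ 0 → v ≡ 0 → j ≡ suc s → d ≡ u + suc s + m → e ≡ d + 1 →
  2 ^ (d + 1) * ratioNum u m s + (2 ^ (d + 1 ∸ j) + 2 ^ j ∸ 1) * ratioDen u v e ≡ 2 ^ (d + 1) * ratioDen u v e
ratio-tight m s refl refl refl refl refl = begin
  D * N + c * X    ≡⟨ cong (λ x → D * N + c * x) X≡D ⟩
  D * N + c * D    ≡⟨ cong (D * N +_) (*-comm c D) ⟩
  D * N + D * c    ≡⟨ sym (*-distribˡ-+ D N c) ⟩
  D * (N + c)      ≡⟨ cong (D *_) (trans N+c≡D (sym X≡D)) ⟩
  D * X            ∎
  where
  open ≡-Reasoning
  d = suc s + m
  D = 2 ^ (d + 1)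
  N = ratioNum 0 m s
  X = ratioDen 0 0 (d + 1)
  c = 2 ^ (d + 1 ∸ suc s) + 2 ^ suc s ∸ 1
  F = mersenne (suc m)
  G = mersenne (suc s)
  X≡D : X ≡ D
  X≡D = trans (*-identityʳ (D * 1)) (*-identityʳ D)
  d+1∸[1+s]≡1+m : d + 1 ∸ suc s ≡ suc m
  d+1∸[1+s]≡1+m = trans (cong (_∸ suc s) (+-assoc (suc s) m 1)) (trans (m+n∸m≡n (suc s) (m + 1)) (+-comm m 1))
  c≡ : c ≡ F + suc G
  c≡ = cong₂ (λ x y → x + y ∸ 1)
    (trans (cong (2 ^_) d+1∸[1+s]≡1+m) (sym (suc-mersenne (suc m)))) (sym (suc-mersenne (suc s)))
  product : ∀ F G → 1 * F * G + (F + (1 + G)) ≡ (1 + F) * (1 + G)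
  product = solve-∀
  N+c≡D : N + c ≡ D
  N+c≡D = begin
    N + c                    ≡⟨ cong (N +_) c≡ ⟩
    1 * F * G + (F + suc G)  ≡⟨ product F G ⟩
    suc F * suc G            ≡⟨ cong₂ _*_ (suc-mersenne (suc m)) (suc-mersenne (suc s)) ⟩
    2 ^ suc m * 2 ^ suc s    ≡⟨ sym (^-distribˡ-+-* 2 (suc m) (suc s)) ⟩
    2 ^ (suc m + suc s)      ≡⟨ cong (2 ^_) (exponent m s) ⟩
    D                        ∎
    where
    exponent : ∀ m s → (1 + m) + (1 + s) ≡ (1 + s) + m + 1
    exponent = solve-∀

-- Alternating sums

sgn : ℕ → ℤ
sgn k = -1ℤ ℤ.^ k

∣sgn*x∣≡∣x∣ : ∀ k x → ∣ sgn k ℤ.* x ∣ ≡ ∣ x ∣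
∣sgn*x∣≡∣x∣ k x = trans (ℤₚ.abs-* (sgn k) x) (trans (cong (_* ∣ x ∣) (∣sgn∣≡1 k)) (*-identityˡ ∣ x ∣))
  where
  ∣sgn∣≡1 : ∀ k → ∣ sgn k ∣ ≡ 1
  ∣sgn∣≡1 zero    = refl
  ∣sgn∣≡1 (suc k) = trans (ℤₚ.abs-* -1ℤ (sgn k)) (cong (1 *_) (∣sgn∣≡1 k))

alternating : (ℕ → ℕ) → ℕ → ℕ → ℤ
alternating a j t = sgn (j ∸ t) ℤ.* ℤ.+ a t

∣alternating∣ : ∀ a j t → ∣ alternating a j t ∣ ≡ a t
∣alternating∣ a j t = ∣sgn*x∣≡∣x∣ (j ∸ t) (ℤ.+ a t)

-- altSum a t = a t − a (t − 1) + a (t − 2) − ⋯, truncated subtraction being exact when a increases.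
altSum : (ℕ → ℕ) → ℕ → ℕ
altSum a zero    = a 0
altSum a (suc t) = a (suc t) ∸ altSum a t

altSum≤ : ∀ a t → altSum a t ≤ a t
altSum≤ a zero    = ≤-refl
altSum≤ a (suc t) = m∸n≤m (a (suc t)) (altSum a t)

sum-alternating-suc : ∀ a j t x → suc t ≤ j → sum0 t (alternating a j) ≡ sgn (j ∸ t) ℤ.* x →
  sum0 (suc t) (alternating a j) ≡ sgn (j ∸ suc t) ℤ.* (ℤ.+ a (suc t) ℤ.- x)
sum-alternating-suc a j t x t<j sum≡ = begin
  sum0 t (alternating a j) ℤ.+ alternating a j (suc t)
    ≡⟨ cong (ℤ._+ alternating a j (suc t)) sum≡ ⟩
  sgn (j ∸ t) ℤ.* x ℤ.+ sgn (j ∸ suc t) ℤ.* ℤ.+ a (suc t)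
    ≡⟨ cong (λ k → sgn k ℤ.* x ℤ.+ sgn (j ∸ suc t) ℤ.* ℤ.+ a (suc t)) (m∸n≡1+[m∸1+n] t<j) ⟩
  (-1ℤ ℤ.* sgn (j ∸ suc t)) ℤ.* x ℤ.+ sgn (j ∸ suc t) ℤ.* ℤ.+ a (suc t)
    ≡⟨ flip-sign (sgn (j ∸ suc t)) x (ℤ.+ a (suc t)) ⟩
  sgn (j ∸ suc t) ℤ.* (ℤ.+ a (suc t) ℤ.- x)
    ∎
  where
  open ≡-Reasoning
  flip-sign : ∀ g x y → (-1ℤ ℤ.* g) ℤ.* x ℤ.+ g ℤ.* y ≡ g ℤ.* (y ℤ.- x)
  flip-sign = ℤ-Solver.solve-∀

sum-alternating : ∀ a j t → t ≤ j → (∀ r → r < t → a r ≤ a (suc r)) →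
  sum0 t (alternating a j) ≡ sgn (j ∸ t) ℤ.* ℤ.+ altSum a t
sum-alternating a j zero    _   _    = refl
sum-alternating a j (suc t) t<j incr = begin
  sum0 (suc t) (alternating a j)
    ≡⟨ sum-alternating-suc a j t _ t<j (sum-alternating a j t (<⇒≤ t<j) (λ r r<t → incr r (m<n⇒m<1+n r<t))) ⟩
  sgn (j ∸ suc t) ℤ.* (ℤ.+ a (suc t) ℤ.- ℤ.+ altSum a t)
    ≡⟨ cong (sgn (j ∸ suc t) ℤ.*_) (trans (ℤₚ.[+m]-[+n]≡m⊖n (a (suc t)) (altSum a t)) (ℤₚ.⊖-≥ S≤a[1+t])) ⟩
  sgn (j ∸ suc t) ℤ.* ℤ.+ altSum a (suc t)
    ∎
  where
  open ≡-Reasoning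
  S≤a[1+t] : altSum a t ≤ a (suc t)
  S≤a[1+t] = ≤-trans (altSum≤ a t) (incr t ≤-refl)

∣sum-alternating∣ : ∀ a j s → suc s ≤ j → (∀ r → r < s → a r ≤ a (suc r)) →
  ∣ sum0 (suc s) (alternating a j) ∣ ≡ ∣ a (suc s) - altSum a s ∣
∣sum-alternating∣ a j s s<j incr = begin
  ∣ sum0 (suc s) (alternating a j) ∣
    ≡⟨ cong ∣_∣ (sum-alternating-suc a j s _ s<j (sum-alternating a j s (<⇒≤ s<j) incr)) ⟩
  ∣ sgn (j ∸ suc s) ℤ.* (ℤ.+ a (suc s) ℤ.- ℤ.+ altSum a s) ∣
    ≡⟨ ∣sgn*x∣≡∣x∣ (j ∸ suc s) _ ⟩
  ∣ ℤ.+ a (suc s) ℤ.- ℤ.+ altSum a s ∣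
    ≡⟨ ∣+m-+n∣≡∣m-n∣ (a (suc s)) (altSum a s) ⟩
  ∣ a (suc s) - altSum a s ∣
    ∎
  where open ≡-Reasoning

-- From ratios to differences

ratio-≤ : ∀ {P A X Y k} → .{{NonZero X}} → P * X ≡ A * Y → Y ≤ k * X → P ≤ k * A
ratio-≤ {P} {A} {X} {Y} {k} PX≡AY Y≤kX = *-cancelʳ-≤ P (k * A) X (begin
  P * X        ≡⟨ PX≡AY ⟩
  A * Y        ≤⟨ *-monoʳ-≤ A Y≤kX ⟩
  A * (k * X)  ≡⟨ x∙yz≈yx∙z A k X ⟩
  k * A * X    ∎)
  where open ≤-Reasoning

ratio-lower : ∀ {P A X Y c D} → .{{NonZero X}} → P * X ≡ A * Y → D * Y + c * X ≤ D * X →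
  A * c ≤ (A ∸ P) * D
ratio-lower {P} {A} {X} {Y} {c} {D} PX≡AY DY+cX≤DX = *-cancelʳ-≤ (A * c) ((A ∸ P) * D) X (begin
  A * c * X                  ≤⟨ m+n≤o⇒m≤o∸n (A * c * X) scaled ⟩
  A * D * X ∸ A * D * Y      ≡⟨ cong (A * D * X ∸_) ADY≡PDX ⟩
  A * D * X ∸ P * D * X      ≡⟨ sym (*-distribʳ-∸ X (A * D) (P * D)) ⟩
  (A * D ∸ P * D) * X        ≡⟨ cong (_* X) (sym (*-distribʳ-∸ D A P)) ⟩
  (A ∸ P) * D * X            ∎)
  where
  open ≤-Reasoning
  distribute : ∀ A c X D Y → A * (D * Y + c * X) ≡ A * c * X + A * D * Y
  distribute = solve-∀
  scaled : A * c * X + A * D * Y ≤ A * D * X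
  scaled = subst₂ _≤_ (distribute A c X D Y) (sym (*-assoc A D X)) (*-monoʳ-≤ A DY+cX≤DX)
  ADY≡PDX : A * D * Y ≡ P * D * X
  ADY≡PDX = begin-equality
    A * D * Y    ≡⟨ xy∙z≈xz∙y A D Y ⟩
    A * Y * D    ≡⟨ cong (_* D) (sym PX≡AY) ⟩
    P * X * D    ≡⟨ xy∙z≈xz∙y P X D ⟩
    P * D * X    ∎

kY≤lX⇒kY+cX≤[l+c]X : ∀ {k l c Y X} → k * Y ≤ l * X → k * Y + c * X ≤ (l + c) * X
kY≤lX⇒kY+cX≤[l+c]X {k} {l} {c} {Y} {X} kY≤lX = subst (k * Y + c * X ≤_) (sym (*-distribʳ-+ X l c)) (+-monoˡ-≤ (c * X) kY≤lX)

Bounds : (d e n j Bv Th : ℕ) → Set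
Bounds d e n j Bv Th = Th ≢ 0 × Bv ≤ Th
  × (n < j → d + 1 ≤ e → Th * 1 ≤ Bv * 3)
  × (n > j → d + 1 ≤ e → Th * 2 ≤ Bv * 3)
  × (n ≡ j → d + 2 ≤ e → Th * 1 ≤ Bv * 2)
  × (n ≡ j → e ≡ d + 1 → Th * (2 ^ (d + 1 ∸ j) + 2 ^ j ∸ 1) ≤ Bv * 2 ^ (d + 1))

absT-increasing : ∀ {d e n j r} → d ≤ e → j ≤ d → suc r ≤ j → suc r < n →
  absT d e n j r ≤ absT d e n j (suc r)
absT-increasing {d} {e} {n} {j} {r} d≤e j≤d r<j r+1<n = begin
  absT d e n j r            ≤⟨ ratio-≤ {absT d e n j r} {absT d e n j (suc r)} {ratioDen u v e} {ratioNum u m r} {1}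
                                  (absT-ratio {e = e} r<j (<⇒≤ r+1<n) j≤d) (ratio≤1 u v m r (m≡[n∸o]+o+[m∸n] r<j j≤d) d≤e (m<n⇒0<n∸m r+1<n)) ⟩
  1 * absT d e n j (suc r)  ≡⟨ *-identityˡ _ ⟩
  absT d e n j (suc r)      ∎
  where
  open ≤-Reasoning
  u = j ∸ suc r
  v = n ∸ suc r
  m = d ∸ j
  instance
    ratioDen≢0 : NonZero (ratioDen u v e)
    ratioDen≢0 = ratioDen-nonZero u v e

bounds-zero : ∀ {d e j x} → x ≢ 0 → Bounds d e 0 (suc j) x x
bounds-zero {x = x} x≢0 = x≢0 , ≤-refl , (λ _ _ → *-monoʳ-≤ x (s≤s z≤n)) , (λ ()) , (λ ()) , (λ ())

bounds-suc : ∀ {d e n j s} → d ≤ e → j ≤ d → j ⊓ n ≡ suc s →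
  Bounds d e n j ∣ absT d e n j (suc s) - altSum (absT d e n j) s ∣ (absT d e n j (suc s))
bounds-suc {d} {e} {n} {j} {s} d≤e j≤d j⊓n≡1+s =
    n>0⇒n≢0 (absT-pos {e = e} s<j j≤d s<n)
  , ∣m-n∣≤m (≤-trans (altSum≤ a s) (ratio-≤ {a s} {a (suc s)} {X} {N} {2} ratio (ratio≤2 u v m s d≡ d≤e)))
  , (λ n<j d+1≤e → lower (kY≤lX⇒kY+cX≤[l+c]X {3} {2} {1} {N} {X} (ratio≤2/3 u v m s d≡ (1≤u n<j) (1+d≤ d+1≤e))))
  , (λ j<n d+1≤e → lower (kY≤lX⇒kY+cX≤[l+c]X {3} {1} {2} {N} {X} (ratio≤1/3 u v m s d≡ (1≤v j<n) (1+d≤ d+1≤e))))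
  , (λ _ d+2≤e → lower (kY≤lX⇒kY+cX≤[l+c]X {2} {1} {1} {N} {X} (ratio≤1/2 u v m s d≡ (subst (_≤ e) (+-comm d 2) d+2≤e))))
  , (λ n≡j e≡d+1 → lower (≤-reflexive (ratio-tight m s (u≡0 n≡j) (v≡0 n≡j) (j≡1+s n≡j) d≡ e≡d+1)))
  where
  a = absT d e n j
  u = j ∸ suc s
  v = n ∸ suc s
  m = d ∸ j
  N = ratioNum u m s
  X = ratioDen u v e
  instance
    X≢0 : NonZero X
    X≢0 = ratioDen-nonZero u v e
  s<j : suc s ≤ j
  s<j = subst (_≤ j) j⊓n≡1+s (m⊓n≤m j n)
  s<n : suc s ≤ n
  s<n = subst (_≤ n) j⊓n≡1+s (m⊓n≤n j n)
  d≡ : d ≡ u + suc s + m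
  d≡ = m≡[n∸o]+o+[m∸n] s<j j≤d
  ratio : a s * X ≡ a (suc s) * N
  ratio = absT-ratio {e = e} s<j s<n j≤d
  lower : ∀ {c D} → D * N + c * X ≤ D * X →
    a (suc s) * c ≤ ∣ a (suc s) - altSum a s ∣ * D
  lower {c} {D} cond = ≤-trans (ratio-lower {a s} {a (suc s)} {X} {N} {c} {D} ratio cond)
    (*-monoˡ-≤ D (≤-trans (∸-monoʳ-≤ (a (suc s)) (altSum≤ a s)) (m∸n≤∣m-n∣ (a (suc s)) (altSum a s))))
  1+d≤ : d + 1 ≤ e → suc d ≤ e
  1+d≤ = subst (_≤ e) (+-comm d 1)
  1≤u : n < j → 1 ≤ u
  1≤u n<j = m<n⇒0<n∸m (subst (_< j) j⊓n≡1+s (m<n⇒o⊓m<n j n<j))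
  1≤v : j < n → 1 ≤ v
  1≤v j<n = m<n⇒0<n∸m (subst (_< n) j⊓n≡1+s (m<n⇒m⊓o<n n j<n))
  j≡1+s : n ≡ j → j ≡ suc s
  j≡1+s n≡j = trans (sym (⊓-idem j)) (subst (λ x → j ⊓ x ≡ suc s) n≡j j⊓n≡1+s)
  u≡0 : n ≡ j → u ≡ 0
  u≡0 n≡j = trans (cong (_∸ suc s) (j≡1+s n≡j)) (n∸n≡0 (suc s))
  v≡0 : n ≡ j → v ≡ 0
  v≡0 n≡j = trans (cong (_∸ suc s) (trans n≡j (j≡1+s n≡j))) (n∸n≡0 (suc s))

bounds : ∀ d e n j → d ≤ e → 1 ≤ j → j ≤ d →
  Bounds d e n j ∣ sum0 (j ⊓ n) (alternating (absT d e n j) j) ∣ ∣ alternating (absT d e n j) j (j ⊓ n) ∣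
bounds d e zero    (suc j) d≤e _ j≤d =
  bounds-zero (n>0⇒n≢0 (subst (1 ≤_) (sym (∣alternating∣ (absT d e 0 (suc j)) (suc j) 0)) (absT-pos {e = e} {n = 0} z≤n j≤d z≤n)))
bounds d e (suc n) (suc j) d≤e _ j≤d = subst₂ (Bounds d e (suc n) (suc j))
  (sym (∣sum-alternating∣ a (suc j) s (s≤s (m⊓n≤m j n)) increasing))
  (sym (∣alternating∣ a (suc j) (suc s)))
  (bounds-suc d≤e j≤d refl)
  where
  a = absT d e (suc n) (suc j)
  s = j ⊓ n
  increasing : ∀ r → r < s → a r ≤ a (suc r)
  increasing r r<s = absT-increasing d≤e j≤d (s≤s (≤-trans (<⇒≤ r<s) (m⊓n≤m j n))) (s≤s (<-≤-trans r<s (m⊓n≤n j n)))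

lemma4p4 : (d e i j : ℕ) → 1 ≤ d → d ≤ e → i ≤ d → 1 ≤ j → j ≤ d →
    let h = hh d i j
        Bv = ∣ B d e i j ∣
        Th = ∣ T d e i j h ∣
    in Th ≢ 0 × Bv ≤ Th
       × (d ∸ i < j → d + 1 ≤ e → Th * 1 ≤ Bv * 3)
       × (d ∸ i > j → d + 1 ≤ e → Th * 2 ≤ Bv * 3)
       × (d ∸ i ≡ j → d + 2 ≤ e → Th * 1 ≤ Bv * 2)
       × (d ∸ i ≡ j → e ≡ d + 1 → Th * (2 ^ (d + 1 ∸ j) + 2 ^ j ∸ 1) ≤ Bv * 2 ^ (d + 1))
lemma4p4 d e i j _ d≤e _ 1≤j j≤d = bounds d e (d ∸ i) j d≤e 1≤j j≤d
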